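{- Let $\mathrm{ttm}$ be the twisted Thue–Morse sequence: $\mathrm{ttm}(0)=0$ and, for $n\ge1$, $\mathrm{ttm}(n)$ is the number of $0$'s in the base-$2$ representation of $n$, taken modulo $2$. Then the running sum $\mathrm{sum}_{\mathrm{ttm}}(n)=\sum_{i=0}^{n}\mathrm{ttm}(i)$ is $2$-synchronised.
   Context: A function $f:\mathbb{N}\to\mathbb{N}$ is $2$-synchronised if there is a finite automaton which, reading the base-$2$ representations of $n$ and $m$ in parallel (the shorter padded with zeros on the most significant side), accepts exactly the pairs $(n,m)$ with $m=f(n)$. -}

module Defs where

open import Data.Nat using (ℕ; zero; suc; _+_; _∸_; _%_; _/_; _≡ᵇ_)
open import Data.Bool using (Bool; true; false; not; if_then_else_)
open import Data.List using (List; []; _∷_; reverse; length; replicate; _++_; zip; foldl; filter)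
open import Data.Product using (_×_; _,_; Σ)
open import Data.Fin using (Fin)
open import Relation.Binary.PropositionalEquality using (_≡_)
open import Function.Bundles using (_⇔_)

lsdBits : ℕ → ℕ → List Bool
lsdBits zero    _ = []
lsdBits (suc f) zero = []
lsdBits (suc f) n@(suc _) = (n % 2 ≡ᵇ 1) ∷ lsdBits f (n / 2)

-- canonical base-2 representation, most significant digit first,
-- no leading zeros; 0 is represented by the empty word
bin : ℕ → List Bool
bin n = reverse (lsdBits n n)

padTo : ℕ → List Bool → List Bool
padTo k xs = replicate (k ∸ length xs) false ++ xs

_⊔ℓ_ : ℕ → ℕ → ℕ
a ⊔ℓ b = Data.Nat._⊔_ a b

pairWord : ℕ → ℕ → List (Bool × Bool)
pairWord n m = zip (padTo L (bin n)) (padTo L (bin m))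
  where L = length (bin n) ⊔ℓ length (bin m)

record DFA (A : Set) (k : ℕ) : Set where
  field
    start  : Fin k
    δ      : Fin k → A → Fin k
    accept : Fin k → Bool

run : ∀ {A k} → DFA A k → List A → Fin k
run M w = foldl (DFA.δ M) (DFA.start M) w

accepts : ∀ {A k} → DFA A k → List A → Bool
accepts M w = DFA.accept M (run M w)

Synchronised2 : (ℕ → ℕ) → Set
Synchronised2 f = Σ ℕ λ k → Σ (DFA (Bool × Bool) k) λ M →
  ∀ n m → (accepts M (pairWord n m) ≡ true) ⇔ (m ≡ f n)

zeros : ℕ → ℕ
zeros n = length (filter (λ b → Data.Bool._≟_ b false) (bin n))

ttm : ℕ → ℕ
ttm zero = 0
ttm n@(suc _) = zeros n % 2

sumTtm : ℕ → ℕ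
sumTtm zero = ttm 0
sumTtm (suc n) = sumTtm n + ttm (suc n)

{-# OPTIONS --safe #-}
module Submission where

-- Since zeros (2a) = zeros a + 1 and zeros (2a + 1) = zeros a for a ≥ 1, we get
-- ttm (2a) + ttm (2a + 1) = 1, hence sumTtm (2i + 1) = i and in general
-- sumTtm n = ⌊n/2⌋ − deficit n, where deficit n = 1 exactly when n is even, positive
-- and has an even number of zeros.  Reading n and m most significant digit first,
-- the last digit read, whether n is nonzero so far, the parity of its zeros, and
-- whether the prefix of ⌊n/2⌋ exceeds the prefix of m by 0, 1 or something else are
-- all updated digit by digit, and together they decide m ≡ sumTtm n.

open import Defs
open import Data.Bool using (Bool; true; false; not; _∧_; _∨_; _xor_; _≟_)
open import Data.Bool.Properties using (xor-comm; not-involutive)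
open import Data.Fin using (Fin)
open import Data.Fin.Patterns using (0F; 1F; 2F)
open import Data.Fin.Properties using (2↔Bool; *↔×)
open import Data.List using (List; []; _∷_; _∷ʳ_; [_]; foldl; filter; length; replicate; reverse; zip; _++_)
open import Data.List.Properties using (foldl-++; foldl-∷ʳ; filter-++; length-++; length-replicate; unfold-reverse)
open import Data.Maybe using (Maybe; just; nothing)
import Data.Maybe.Properties as Maybe
open import Data.Nat using (ℕ; zero; suc; _+_; _*_; _∸_; _%_; _/_; _≡ᵇ_; _≤_; _⊔_; ⌊_/2⌋; z≤n; s≤s; s≤s⁻¹)
open import Data.Nat.DivMod using (m/n≡1+[m∸n]/n)
open import Data.Nat.Induction using (<-rec)
open import Data.Nat.Properties using (≤-refl; ≤-trans; ⌊n/2⌋<n; suc-injective; m≤m⊔n; m≤n⊔m; m∸n+n≡m; +-cancelʳ-≡; +-comm; +-assoc; +-identityʳ)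
open import Data.Product using (_×_; _,_)
open import Data.Product.Function.NonDependent.Propositional using (_×-↔_)
open import Function using (_∘_)
open import Function.Bundles using (_⇔_; _↔_; mk⇔; mk↔ₛ′; Inverse)
import Function.Properties.Equivalence as ⇔
open import Function.Properties.Inverse using (↔-trans)
open import Relation.Binary.PropositionalEquality using (_≡_; refl; sym; trans; cong; cong₂; subst; module ≡-Reasoning)
open import Relation.Nullary using (Dec; yes; no; does; contradiction)

open ≡-Reasoning

digit : Bool → ℕ
digit false = 0
digit true  = 1

-- appendBit a x = 2a + x, by a recursion that computes on suc a whatever x is.
appendBit : ℕ → Bool → ℕ
appendBit zero    x = digit x
appendBit (suc a) x = suc (suc (appendBit a x))

fromBits : List Bool → ℕ
fromBits = foldl appendBit 0

isOdd : ℕ → Bool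
isOdd zero          = false
isOdd (suc zero)    = true
isOdd (suc (suc n)) = isOdd n

isNonZero : ℕ → Bool
isNonZero zero    = false
isNonZero (suc _) = true

isOdd-suc : ∀ n → isOdd (suc n) ≡ not (isOdd n)
isOdd-suc zero          = refl
isOdd-suc (suc zero)    = refl
isOdd-suc (suc (suc n)) = isOdd-suc n

isOdd-+ : ∀ m n → isOdd (m + n) ≡ isOdd m xor isOdd n
isOdd-+ zero          n = refl
isOdd-+ (suc zero)    n = isOdd-suc n
isOdd-+ (suc (suc m)) n = isOdd-+ m n

isOdd-digit : ∀ x → isOdd (digit x) ≡ x
isOdd-digit false = refl
isOdd-digit true  = refl

isOdd-appendBit : ∀ a x → isOdd (appendBit a x) ≡ x
isOdd-appendBit zero    x = isOdd-digit x
isOdd-appendBit (suc a) x = isOdd-appendBit a x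

⌊appendBit/2⌋ : ∀ a x → ⌊ appendBit a x /2⌋ ≡ a
⌊appendBit/2⌋ zero    false = refl
⌊appendBit/2⌋ zero    true  = refl
⌊appendBit/2⌋ (suc a) x     = cong suc (⌊appendBit/2⌋ a x)

appendBit-⌊/2⌋ : ∀ n → appendBit ⌊ n /2⌋ (isOdd n) ≡ n
appendBit-⌊/2⌋ zero          = refl
appendBit-⌊/2⌋ (suc zero)    = refl
appendBit-⌊/2⌋ (suc (suc n)) = cong (suc ∘ suc) (appendBit-⌊/2⌋ n)

appendBit-true : ∀ a → appendBit a true ≡ suc (appendBit a false)
appendBit-true zero    = refl
appendBit-true (suc a) = cong (suc ∘ suc) (appendBit-true a)

n/2≡⌊n/2⌋ : ∀ n → n / 2 ≡ ⌊ n /2⌋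
n/2≡⌊n/2⌋ zero          = refl
n/2≡⌊n/2⌋ (suc zero)    = refl
n/2≡⌊n/2⌋ (suc (suc n)) =
  trans (m/n≡1+[m∸n]/n {suc (suc n)} {2} (s≤s (s≤s z≤n))) (cong suc (n/2≡⌊n/2⌋ n))

n%2≡digit[isOdd] : ∀ n → n % 2 ≡ digit (isOdd n)
n%2≡digit[isOdd] zero          = refl
n%2≡digit[isOdd] (suc zero)    = refl
n%2≡digit[isOdd] (suc (suc n)) = n%2≡digit[isOdd] n

[n%2≡ᵇ1]≡isOdd : ∀ n → (n % 2 ≡ᵇ 1) ≡ isOdd n
[n%2≡ᵇ1]≡isOdd n rewrite n%2≡digit[isOdd] n with isOdd n
... | false = refl
... | true  = refl

lsdBits-fuel : ∀ {f g n} → n ≤ f → n ≤ g → lsdBits f n ≡ lsdBits g n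
lsdBits-fuel {zero}  {zero}  _ _ = refl
lsdBits-fuel {zero}  {suc _} z≤n _ = refl
lsdBits-fuel {suc _} {zero}  _ z≤n = refl
lsdBits-fuel {suc _} {suc _} {zero} _ _ = refl
lsdBits-fuel {suc _} {suc _} {suc n} (s≤s n≤f) (s≤s n≤g) =
  cong (_ ∷_) (lsdBits-fuel (≤-trans half≤n n≤f) (≤-trans half≤n n≤g))
  where
  half≤n : suc n / 2 ≤ n
  half≤n = subst (_≤ n) (sym (n/2≡⌊n/2⌋ (suc n))) (s≤s⁻¹ (⌊n/2⌋<n n))

bin-suc : ∀ n → bin (suc n) ≡ bin ⌊ suc n /2⌋ ∷ʳ isOdd (suc n)
bin-suc n = begin
  reverse (lsdBits (suc n) (suc n))
    ≡⟨ unfold-reverse _ (lsdBits n (suc n / 2)) ⟩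
  reverse (lsdBits n (suc n / 2)) ∷ʳ (suc n % 2 ≡ᵇ 1)
    ≡⟨ cong₂ (λ xs x → reverse xs ∷ʳ x) lsdBits-half ([n%2≡ᵇ1]≡isOdd (suc n)) ⟩
  bin ⌊ suc n /2⌋ ∷ʳ isOdd (suc n) ∎
  where
  lsdBits-half : lsdBits n (suc n / 2) ≡ lsdBits ⌊ suc n /2⌋ ⌊ suc n /2⌋
  lsdBits-half = trans (cong (lsdBits n) (n/2≡⌊n/2⌋ (suc n)))
                       (lsdBits-fuel (s≤s⁻¹ (⌊n/2⌋<n n)) ≤-refl)

fromBits-bin : ∀ n → fromBits (bin n) ≡ n
fromBits-bin = <-rec (λ n → fromBits (bin n) ≡ n) λ where
  zero    _   → refl
  (suc n) rec → let h = ⌊ suc n /2⌋ ; b = isOdd (suc n) in begin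
    fromBits (bin (suc n))         ≡⟨ cong fromBits (bin-suc n) ⟩
    fromBits (bin h ∷ʳ b)          ≡⟨ foldl-∷ʳ appendBit 0 b (bin h) ⟩
    appendBit (fromBits (bin h)) b ≡⟨ cong (λ a → appendBit a b) (rec (⌊n/2⌋<n n)) ⟩
    appendBit h b                  ≡⟨ appendBit-⌊/2⌋ (suc n) ⟩
    suc n                          ∎

fromBits-padTo : ∀ L xs → fromBits (padTo L xs) ≡ fromBits xs
fromBits-padTo L xs =
  trans (foldl-++ appendBit 0 (replicate (L ∸ length xs) false) xs)
        (cong (λ a → foldl appendBit a xs) (fromBits-zeros (L ∸ length xs)))
  where
  fromBits-zeros : ∀ k → fromBits (replicate k false) ≡ 0
  fromBits-zeros zero    = refl
  fromBits-zeros (suc k) = fromBits-zeros k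

length-padTo : ∀ {L} xs → length xs ≤ L → length (padTo L xs) ≡ L
length-padTo {L} xs len≤L = begin
  length (replicate (L ∸ length xs) false ++ xs)
    ≡⟨ length-++ (replicate (L ∸ length xs) false) ⟩
  length (replicate (L ∸ length xs) false) + length xs
    ≡⟨ cong (_+ length xs) (length-replicate (L ∸ length xs)) ⟩
  L ∸ length xs + length xs
    ≡⟨ m∸n+n≡m len≤L ⟩
  L ∎

zeros-suc : ∀ n → zeros (suc n) ≡ zeros ⌊ suc n /2⌋ + digit (not (isOdd (suc n)))
zeros-suc n = begin
  length (filter isZero? (bin (suc n)))                   ≡⟨ cong (length ∘ filter isZero?) (bin-suc n) ⟩
  length (filter isZero? (bin h ++ [ b ]))                ≡⟨ cong length (filter-++ isZero? (bin h) [ b ]) ⟩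
  length (filter isZero? (bin h) ++ filter isZero? [ b ]) ≡⟨ length-++ (filter isZero? (bin h)) ⟩
  zeros h + length (filter isZero? [ b ])                 ≡⟨ cong (zeros h +_) (count-singleton b) ⟩
  zeros h + digit (not b)                                 ∎
  where
  isZero? : (x : Bool) → Dec (x ≡ false)
  isZero? = _≟ false
  h : ℕ
  h = ⌊ suc n /2⌋
  b : Bool
  b = isOdd (suc n)
  count-singleton : ∀ x → length (filter isZero? [ x ]) ≡ digit (not x)
  count-singleton false = refl
  count-singleton true  = refl

module _ {S : Set} {k : ℕ} (Fin↔S : Fin k ↔ S) where
  open Inverse Fin↔S using (to; from; strictlyInverseˡ)

  dfaOf : {A : Set} → S → (S → A → S) → (S → Bool) → DFA A k
  dfaOf s₀ step accept = record
    { start = from s₀ ; δ = λ q a → from (step (to q) a) ; accept = accept ∘ to }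

  to-run-dfaOf : ∀ {A} s₀ (step : S → A → S) accept w →
                 to (run (dfaOf s₀ step accept) w) ≡ foldl step s₀ w
  to-run-dfaOf s₀ step accept = go s₀
    where
    go : ∀ s w → to (foldl (DFA.δ (dfaOf s₀ step accept)) (from s) w) ≡ foldl step s w
    go s []      = strictlyInverseˡ s
    go s (a ∷ w) = trans (cong (λ t → to (foldl _ (from (step t a)) w)) (strictlyInverseˡ s))
                         (go (step s a) w)

module _ {S : Set} (inv : ℕ → ℕ → S) (step : S → Bool × Bool → S)
         (step-inv : ∀ a b x y → step (inv a b) (x , y) ≡ inv (appendBit a x) (appendBit b y)) where

  foldl-zip : ∀ xs ys → length xs ≡ length ys → ∀ a b →
              foldl step (inv a b) (zip xs ys) ≡ inv (foldl appendBit a xs) (foldl appendBit b ys)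
  foldl-zip []       []       _   a b = refl
  foldl-zip (x ∷ xs) (y ∷ ys) len a b =
    trans (cong (λ s → foldl step s (zip xs ys)) (step-inv a b x y))
          (foldl-zip xs ys (suc-injective len) (appendBit a x) (appendBit b y))

  foldl-pairWord : ∀ n m → foldl step (inv 0 0) (pairWord n m) ≡ inv n m
  foldl-pairWord n m = begin
    foldl step (inv 0 0) (zip (padTo L (bin n)) (padTo L (bin m)))
      ≡⟨ foldl-zip (padTo L (bin n)) (padTo L (bin m)) equal-lengths 0 0 ⟩
    inv (fromBits (padTo L (bin n))) (fromBits (padTo L (bin m)))
      ≡⟨ cong₂ inv (value n) (value m) ⟩
    inv n m ∎
    where
    L : ℕ
    L = length (bin n) ⊔ length (bin m)
    equal-lengths : length (padTo L (bin n)) ≡ length (padTo L (bin m))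
    equal-lengths = trans (length-padTo (bin n) (m≤m⊔n _ _)) (sym (length-padTo (bin m) (m≤n⊔m _ _)))
    value : ∀ n → fromBits (padTo L (bin n)) ≡ n
    value n = trans (fromBits-padTo L (bin n)) (fromBits-bin n)

invariant⇒synchronised : ∀ {f : ℕ → ℕ} {S : Set} {k} → Fin k ↔ S →
  (inv : ℕ → ℕ → S) (step : S → Bool × Bool → S) (accept : S → Bool) →
  (∀ a b x y → step (inv a b) (x , y) ≡ inv (appendBit a x) (appendBit b y)) →
  (∀ n m → (accept (inv n m) ≡ true) ⇔ (m ≡ f n)) →
  Synchronised2 f
invariant⇒synchronised {f} {k = k} Fin↔S inv step accept step-inv accept-inv =
  k , dfaOf Fin↔S (inv 0 0) step accept , λ n m →
    subst (λ b → (b ≡ true) ⇔ (m ≡ f n)) (sym (accepts-inv n m)) (accept-inv n m)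
  where
  accepts-inv : ∀ n m → accepts (dfaOf Fin↔S (inv 0 0) step accept) (pairWord n m) ≡ accept (inv n m)
  accepts-inv n m = cong accept (trans (to-run-dfaOf Fin↔S (inv 0 0) step accept (pairWord n m))
                                       (foldl-pairWord inv step step-inv n m))

offset : ℕ → ℕ → Maybe Bool
offset zero          zero    = just false
offset zero          (suc _) = nothing
offset (suc k)       (suc b) = offset k b
offset (suc zero)    zero    = just true
offset (suc (suc _)) zero    = nothing

offset≡just⇔ : ∀ k b d → (offset k b ≡ just d) ⇔ (k ≡ b + digit d)
offset≡just⇔ k b d = mk⇔ (sound k b) (λ { refl → complete b d })
  where
  sound : ∀ k b → offset k b ≡ just d → k ≡ b + digit d
  sound zero          zero    refl = refl
  sound (suc zero)    zero    refl = refl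
  sound (suc k)       (suc b) eq   = cong suc (sound k b eq)
  complete : ∀ b d → offset (b + digit d) b ≡ just d
  complete zero    false = refl
  complete zero    true  = refl
  complete (suc b) d     = complete b d

-- The offset evolves as 2(k − b) + (c − y), so once it leaves {0, 1} it never returns.
stepOffset : Maybe Bool → Bool → Bool → Maybe Bool
stepOffset (just false) false false = just false
stepOffset (just false) true  true  = just false
stepOffset (just false) true  false = just true
stepOffset (just true)  false true  = just true
stepOffset _            _     _     = nothing

offset-appendBit : ∀ k c b y → offset (appendBit k c) (appendBit b y) ≡ stepOffset (offset k b) c y
offset-appendBit zero          false zero    false = refl
offset-appendBit zero          false zero    true  = refl
offset-appendBit zero          true  zero    false = refl
offset-appendBit zero          true  zero    true  = refl
offset-appendBit zero          false (suc b) y     = refl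
offset-appendBit zero          true  (suc b) y     = refl
offset-appendBit (suc zero)    false zero    false = refl
offset-appendBit (suc zero)    false zero    true  = refl
offset-appendBit (suc zero)    true  zero    false = refl
offset-appendBit (suc zero)    true  zero    true  = refl
offset-appendBit (suc (suc k)) c     zero    false = refl
offset-appendBit (suc (suc k)) c     zero    true  = refl
offset-appendBit (suc k)       c     (suc b) y     = offset-appendBit k c b y

isNonZero-appendBit : ∀ a x → isNonZero (appendBit a x) ≡ isNonZero a ∨ x
isNonZero-appendBit zero    false = refl
isNonZero-appendBit zero    true  = refl
isNonZero-appendBit (suc a) x     = refl

isOdd-zeros-appendBit : ∀ a x → isOdd (zeros (appendBit a x)) ≡ (isNonZero a ∧ not x) xor isOdd (zeros a)
isOdd-zeros-appendBit zero    false = refl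
isOdd-zeros-appendBit zero    true  = refl
isOdd-zeros-appendBit (suc a) x     = begin
  isOdd (zeros (appendBit (suc a) x))
    ≡⟨ cong isOdd (zeros-suc (suc (appendBit a x))) ⟩
  isOdd (zeros ⌊ appendBit (suc a) x /2⌋ + digit (not (isOdd (appendBit (suc a) x))))
    ≡⟨ cong₂ (λ h b → isOdd (zeros h + digit (not b))) (⌊appendBit/2⌋ (suc a) x) (isOdd-appendBit (suc a) x) ⟩
  isOdd (zeros (suc a) + digit (not x))
    ≡⟨ isOdd-+ (zeros (suc a)) (digit (not x)) ⟩
  isOdd (zeros (suc a)) xor isOdd (digit (not x))
    ≡⟨ cong (isOdd (zeros (suc a)) xor_) (isOdd-digit (not x)) ⟩
  isOdd (zeros (suc a)) xor not x
    ≡⟨ xor-comm (isOdd (zeros (suc a))) (not x) ⟩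
  not x xor isOdd (zeros (suc a)) ∎

digit-not+digit : ∀ b → digit (not b) + digit b ≡ 1
digit-not+digit false = refl
digit-not+digit true  = refl

ttm-appendBit : ∀ a x → ttm (appendBit (suc a) x) ≡ digit (not x xor isOdd (zeros (suc a)))
ttm-appendBit a x =
  trans (n%2≡digit[isOdd] (zeros (appendBit (suc a) x)))
        (cong digit (isOdd-zeros-appendBit (suc a) x))

sumTtm-odd : ∀ i → sumTtm (appendBit i true) ≡ i
sumTtm-odd zero    = refl
sumTtm-odd (suc i) = begin
  sumTtm (appendBit i true) + ttm (suc (appendBit i true)) + ttm (appendBit (suc i) true)
    ≡⟨ cong₂ (λ s t → s + ttm (suc t) + ttm (appendBit (suc i) true)) (sumTtm-odd i) (appendBit-true i) ⟩
  i + ttm (appendBit (suc i) false) + ttm (appendBit (suc i) true)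
    ≡⟨ +-assoc i _ _ ⟩
  i + (ttm (appendBit (suc i) false) + ttm (appendBit (suc i) true))
    ≡⟨ cong (i +_) (cong₂ _+_ (ttm-appendBit i false) (ttm-appendBit i true)) ⟩
  i + (digit (not p) + digit p)
    ≡⟨ cong (i +_) (digit-not+digit p) ⟩
  i + 1
    ≡⟨ +-comm i 1 ⟩
  suc i ∎
  where
  p : Bool
  p = isOdd (zeros (suc i))

sumTtm-even : ∀ i → sumTtm (appendBit (suc i) false) ≡ i + ttm (appendBit (suc i) false)
sumTtm-even i = subst (λ n → sumTtm n ≡ i + ttm n) (cong suc (appendBit-true i))
                      (cong (_+ ttm (suc (appendBit i true))) (sumTtm-odd i))

deficit : ℕ → Bool
deficit n = not (isOdd n) ∧ isNonZero n ∧ not (isOdd (zeros n))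

⌊n/2⌋≡sumTtm+deficit : ∀ n → ⌊ n /2⌋ ≡ sumTtm n + digit (deficit n)
⌊n/2⌋≡sumTtm+deficit n = subst Claim (appendBit-⌊/2⌋ n) (claim ⌊ n /2⌋ (isOdd n))
  where
  Claim : ℕ → Set
  Claim n = ⌊ n /2⌋ ≡ sumTtm n + digit (deficit n)
  claim : ∀ a x → Claim (appendBit a x)
  claim zero    false = refl
  claim a       true  = begin
    ⌊ appendBit a true /2⌋                                         ≡⟨ ⌊appendBit/2⌋ a true ⟩
    a                                                              ≡⟨ +-identityʳ a ⟨
    a + 0                                                          ≡⟨ cong₂ _+_ (sumTtm-odd a) (cong digit deficit-odd) ⟨
    sumTtm (appendBit a true) + digit (deficit (appendBit a true)) ∎
    where
    deficit-odd : deficit (appendBit a true) ≡ false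
    deficit-odd = cong (λ c → not c ∧ isNonZero (appendBit a true) ∧ not (isOdd (zeros (appendBit a true))))
                       (isOdd-appendBit a true)
  claim (suc i) false = begin
    ⌊ n′ /2⌋                                  ≡⟨ ⌊appendBit/2⌋ (suc i) false ⟩
    suc i                                     ≡⟨ +-comm 1 i ⟩
    i + 1                                     ≡⟨ cong (i +_) (digit-not+digit p) ⟨
    i + (digit (not p) + digit p)             ≡⟨ +-assoc i _ _ ⟨
    i + digit (not p) + digit p               ≡⟨ cong₂ (λ t d → i + t + digit d) (ttm-appendBit i false) deficit-n′ ⟨
    i + ttm n′ + digit (deficit n′)           ≡⟨ cong (_+ digit (deficit n′)) (sumTtm-even i) ⟨
    sumTtm n′ + digit (deficit n′)            ∎
    where
    n′ : ℕ
    n′ = appendBit (suc i) false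
    p : Bool
    p = isOdd (zeros (suc i))
    deficit-n′ : deficit n′ ≡ p
    deficit-n′ = begin
      not (isOdd n′) ∧ not (isOdd (zeros n′))
        ≡⟨ cong₂ (λ c z → not c ∧ not z) (isOdd-appendBit (suc i) false) (isOdd-zeros-appendBit (suc i) false) ⟩
      not (not p)
        ≡⟨ not-involutive p ⟩
      p ∎

does≡true⇔ : ∀ {A : Set} (a? : Dec A) → (does a? ≡ true) ⇔ A
does≡true⇔ (yes a) = mk⇔ (λ _ → a) (λ _ → refl)
does≡true⇔ (no ¬a) = mk⇔ (λ ()) (λ a → contradiction a ¬a)

State : Set
State = Bool × Bool × Bool × Maybe Bool

Fin↔State : Fin (2 * (2 * (2 * 3))) ↔ State
Fin↔State = ↔-trans *↔× (2↔Bool ×-↔ ↔-trans *↔× (2↔Bool ×-↔ ↔-trans *↔× (2↔Bool ×-↔ Fin3↔MaybeBool)))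
  where
  Fin3↔MaybeBool : Fin 3 ↔ Maybe Bool
  Fin3↔MaybeBool = mk↔ₛ′
    (λ { 0F → nothing ; 1F → just false ; 2F → just true })
    (λ { nothing → 0F ; (just false) → 1F ; (just true) → 2F })
    (λ { nothing → refl ; (just false) → refl ; (just true) → refl })
    (λ { 0F → refl ; 1F → refl ; 2F → refl })

sumTtmState : ℕ → ℕ → State
sumTtmState n m = isOdd n , isNonZero n , isOdd (zeros n) , offset ⌊ n /2⌋ m

sumTtmStep : State → Bool × Bool → State
sumTtmStep (c , s , z , o) (x , y) = x , s ∨ x , (s ∧ not x) xor z , stepOffset o c y

sumTtmAccept : State → Bool
sumTtmAccept (c , s , z , o) = does (Maybe.≡-dec _≟_ o (just (not c ∧ s ∧ not z)))

sumTtmStep-appendBit : ∀ a b x y →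
  sumTtmStep (sumTtmState a b) (x , y) ≡ sumTtmState (appendBit a x) (appendBit b y)
sumTtmStep-appendBit a b x y =
  cong₂ _,_ (sym (isOdd-appendBit a x))
  (cong₂ _,_ (sym (isNonZero-appendBit a x))
  (cong₂ _,_ (sym (isOdd-zeros-appendBit a x)) offset-step))
  where
  offset-step : stepOffset (offset ⌊ a /2⌋ b) (isOdd a) y ≡ offset ⌊ appendBit a x /2⌋ (appendBit b y)
  offset-step = begin
    stepOffset (offset ⌊ a /2⌋ b) (isOdd a) y            ≡⟨ offset-appendBit ⌊ a /2⌋ (isOdd a) b y ⟨
    offset (appendBit ⌊ a /2⌋ (isOdd a)) (appendBit b y) ≡⟨ cong (λ k → offset k (appendBit b y)) (appendBit-⌊/2⌋ a) ⟩
    offset a (appendBit b y)                             ≡⟨ cong (λ k → offset k (appendBit b y)) (⌊appendBit/2⌋ a x) ⟨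
    offset ⌊ appendBit a x /2⌋ (appendBit b y)           ∎

sumTtmAccept⇔ : ∀ n m → (sumTtmAccept (sumTtmState n m) ≡ true) ⇔ (m ≡ sumTtm n)
sumTtmAccept⇔ n m =
  ⇔.trans (does≡true⇔ (Maybe.≡-dec _≟_ (offset ⌊ n /2⌋ m) (just (deficit n))))
  (⇔.trans (offset≡just⇔ ⌊ n /2⌋ m (deficit n))
           (mk⇔ (λ eq → +-cancelʳ-≡ (digit (deficit n)) m (sumTtm n) (trans (sym eq) closed-form))
                (λ { refl → closed-form })))
  where
  closed-form : ⌊ n /2⌋ ≡ sumTtm n + digit (deficit n)
  closed-form = ⌊n/2⌋≡sumTtm+deficit n

mainTheorem11 : Synchronised2 sumTtm
mainTheorem11 =
  invariant⇒synchronised Fin↔State sumTtmState sumTtmStep sumTtmAccept sumTtmStep-appendBit sumTtmAccept⇔
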